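{- For every integer $v \ge 8$ there exists at least one lune-free knot graph with exactly $v$ vertices.
   Context: A lune-free graph is a connected $4$-regular plane graph with no loops and no multiple edges (at most one edge between any two vertices). In a $4$-regular plane graph, a straight-ahead circuit is a closed walk that, at each vertex it passes through, leaves along the edge opposite (i.e. not adjacent in the cyclic order of the four edges at that vertex) to the edge by which it entered; the edge set decomposes uniquely into such circuits. A knot graph is a connected $4$-regular plane graph having exactly one straight-ahead circuit (i.e. the whole graph can be traversed in this way), so that it is the shadow of a one-component link (a knot). Vertices are also called nodes or crossings. -}

module Defs where

open import Data.Nat using (ℕ; zero; suc; _+_; _*_)
open import Data.Fin using (Fin; zero; suc)
open import Data.Product using (Σ; _×_; _,_; proj₁; proj₂; ∃)
open import Data.Sum using (_⊎_)
open import Relation.Binary.PropositionalEquality using (_≡_; _≢_)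
open import Relation.Nullary using (¬_)
open import Function.Bundles using (_⇔_)
open import Function.Definitions using (Surjective)

-- A dart (half-edge) is a pair (x , i): the i-th edge-end at vertex x,
-- where i ∈ Fin 4 lists the four edge-ends in their cyclic (rotation) order.
Dart : ℕ → Set
Dart v = Fin v × Fin 4

rot4 : Fin 4 → Fin 4
rot4 zero = suc zero
rot4 (suc zero) = suc (suc zero)
rot4 (suc (suc zero)) = suc (suc (suc zero))
rot4 (suc (suc (suc zero))) = zero

opp4 : Fin 4 → Fin 4
opp4 i = rot4 (rot4 i)

σ : ∀ {v} → Dart v → Dart v
σ (x , i) = (x , rot4 i)

iter : ∀ {A : Set} → (A → A) → ℕ → A → A
iter f zero a = a
iter f (suc k) a = f (iter f k a)

-- A 4-regular map: the edges are given by a fixed-point-free involution α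
-- on darts, pairing the two ends of each edge.
record Map4 (v : ℕ) : Set where
  field
    α        : Dart v → Dart v
    α-invol  : ∀ d → α (α d) ≡ d
    α-nofix  : ∀ d → α d ≢ d
open Map4 public

module _ {v : ℕ} (M : Map4 v) where

  Loopless : Set
  Loopless = ∀ (d : Dart v) → proj₁ (α M d) ≢ proj₁ d

  NoMultiEdges : Set
  NoMultiEdges = ∀ (x : Fin v) (i j : Fin 4) →
    proj₁ (α M (x , i)) ≡ proj₁ (α M (x , j)) → i ≡ j

  data Reach : Dart v → Dart v → Set where
    here  : ∀ {d} → Reach d d
    alongE : ∀ {d e} → Reach d e → Reach d (α M e)
    aroundV : ∀ {d e} → Reach d e → Reach d (σ e)

  Connected : Set
  Connected = ∀ d e → Reach d e

  -- face permutation φ = σ ∘ α; its orbits are the faces of the map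
  φ : Dart v → Dart v
  φ d = σ (α M d)

  SameFace : Dart v → Dart v → Set
  SameFace d e = ∃ λ k → iter φ k d ≡ e

  HasFaces : ℕ → Set
  HasFaces n = Σ (Dart v → Fin n) λ face →
    Surjective _≡_ _≡_ face × (∀ d e → (face d ≡ face e) ⇔ SameFace d e)

  -- plane (genus 0) connected map: Euler's formula V - E + F = 2 with
  -- V = v, E = 2v, i.e. F = v + 2
  Plane : Set
  Plane = Connected × HasFaces (v + 2)

  straight : Dart v → Dart v
  straight d = (proj₁ (α M d) , opp4 (proj₂ (α M d)))

  -- exactly one straight-ahead circuit: the straight-ahead walk starting at
  -- some dart d₀ passes through every edge (each dart occurs in it in one of
  -- the two directions)
  OneStraightAheadCircuit : Set
  OneStraightAheadCircuit = ∃ λ (d₀ : Dart v) → ∀ (d : Dart v) → ∃ λ k →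
    (iter straight k d₀ ≡ d) ⊎ (α M (iter straight k d₀) ≡ d)

  LuneFreeKnotGraph : Set
  LuneFreeKnotGraph = Plane × Loopless × NoMultiEdges × OneStraightAheadCircuit

-- Induction in steps of six crossings. Six lune-free knot graphs with 8 to 13 crossings are
-- given by tables and checked by evaluation; each contains a fixed site, three edges 0–2, 1–2,
-- 1–3 in prescribed rotation positions. Cutting the site edges and splicing in a fixed gadget of
-- six new crossings gives a lune-free knot graph with six more crossings that again contains the
-- site, on the new crossings. Every face of the old map survives, rerouted through the gadget, and
-- the gadget adds six triangles, so Euler's count F = V + 2 persists; the old straight-ahead
-- circuit, rerouted through the gadget, still traverses every edge.
module Submission where

open import Defs
open import Data.Nat using (ℕ; zero; suc; _+_; _*_; _≥_)
open import Data.Nat.Properties using (+-suc; *-suc; +-comm; n<1+n; m≤n⇒∃[o]m+o≡n)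
open import Data.Fin using (Fin; zero; suc; toℕ; combine; _≟_; #_; _↑ˡ_; _↑ʳ_; splitAt; join)
open import Data.Fin.Properties
  using (pigeonhole; combine-injective; all?; any?; ↑ʳ-injective; splitAt-↑ˡ; splitAt⁻¹-↑ˡ;
         splitAt⁻¹-↑ʳ; join-splitAt)
open import Data.Product using (Σ; _×_; _,_; proj₁; proj₂; ∃)
open import Data.Product.Properties using (≡-dec)
open import Data.Sum using (_⊎_; inj₁; inj₂; [_,_]′) renaming (map to ⊎-map)
open import Data.Sum.Properties using () renaming (≡-dec to ≡-dec-⊎)
open import Data.Vec using (Vec; lookup; _∷_; [])
open import Data.Empty using (⊥-elim)
open import Data.Unit using (⊤; tt)
open import Function.Base using (_∘_; id)
open import Function.Bundles using (mk⇔; Equivalence)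
open import Function.Definitions using (Injective)
open import Relation.Nullary using (Dec; yes; no; ¬_)
open import Relation.Nullary.Decidable
  using (True; toWitness; from-yes; toSum; map′; ¬?; _×-dec_; _⊎-dec_; _→-dec_)
open import Relation.Unary using (Decidable)
open import Relation.Binary using (DecidableEquality)
open import Relation.Binary.PropositionalEquality
open ≡-Reasoning

module _ {A : Set} (f : A → A) where

  iter-+ : ∀ m n x → iter f (m + n) x ≡ iter f m (iter f n x)
  iter-+ zero    n x = refl
  iter-+ (suc m) n x = cong f (iter-+ m n x)

  iter-injective : Injective _≡_ _≡_ f → ∀ n → Injective _≡_ _≡_ (iter f n)
  iter-injective f-inj zero    eq = eq
  iter-injective f-inj (suc n) eq = iter-injective f-inj n (f-inj eq)

  iter-*-period : ∀ {p x} → iter f p x ≡ x → ∀ m → iter f (m * p) x ≡ x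
  iter-*-period         period zero    = refl
  iter-*-period {p} {x} period (suc m) = begin
    iter f (p + m * p) x        ≡⟨ iter-+ p (m * p) x ⟩
    iter f p (iter f (m * p) x) ≡⟨ cong (iter f p) (iter-*-period period m) ⟩
    iter f p x                  ≡⟨ period ⟩
    x                           ∎

  -- By pigeonhole two of x, f x, …, fⁿ x coincide; cancelling the shorter prefix gives a period.
  iter-periodic : ∀ {n} (code : A → Fin n) → Injective _≡_ _≡_ code → Injective _≡_ _≡_ f →
                  ∀ x → ∃ λ p → iter f (suc p) x ≡ x
  iter-periodic {n} code code-inj f-inj x =
    let i , j , i<j , same = pigeonhole (n<1+n n) (λ k → code (iter f (toℕ k) x))
        p , i+1+p≡j        = m≤n⇒∃[o]m+o≡n i<j
    in p , iter-injective f-inj (toℕ i) (begin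
         iter f (toℕ i) (iter f (suc p) x) ≡⟨ iter-+ (toℕ i) (suc p) x ⟨
         iter f (toℕ i + suc p) x          ≡⟨ cong (λ m → iter f m x)
                                                     (trans (+-suc (toℕ i) p) i+1+p≡j) ⟩
         iter f (toℕ j) x                  ≡⟨ code-inj same ⟨
         iter f (toℕ i) x                  ∎)

  iter-simulate : ∀ {B : Set} (h : B → A) (g : B → B) →
                  (∀ b → ∃ λ j → iter f j (h b) ≡ h (g b)) →
                  ∀ n b → ∃ λ j → iter f j (h b) ≡ h (iter g n b)
  iter-simulate h g step zero    b = 0 , refl
  iter-simulate h g step (suc n) b =
    let j  , reach = iter-simulate h g step n b
        j′ , next  = step (iter g n b)
    in j′ + j , trans (iter-+ j′ j (h b)) (trans (cong (iter f j′) reach) next)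

vertex : ∀ {v} → Dart v → Fin v
vertex = proj₁

rotation : ∀ {v} → Dart v → Fin 4
rotation = proj₂

σ⁴ : ∀ {v} (d : Dart v) → σ (σ (σ (σ d))) ≡ d
σ⁴ (x , zero)                 = refl
σ⁴ (x , suc zero)             = refl
σ⁴ (x , suc (suc zero))       = refl
σ⁴ (x , suc (suc (suc zero))) = refl

σ⁻¹ : ∀ {v} → Dart v → Dart v
σ⁻¹ d = σ (σ (σ d))

σ-injective : ∀ {v} → Injective _≡_ _≡_ (σ {v})
σ-injective {x = d} {e} eq = trans (sym (σ⁴ d)) (trans (cong σ⁻¹ eq) (σ⁴ e))

across : ∀ {v} → Dart v → Dart v
across (x , i) = (x , opp4 i)

dartCode : ∀ {v} → Dart v → Fin (v * 4)
dartCode (x , i) = combine x i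

dartCode-injective : ∀ {v} → Injective _≡_ _≡_ (dartCode {v})
dartCode-injective {x = x , i} {y , j} eq with refl , refl ← combine-injective x i y j eq = refl

module _ {v : ℕ} (M : Map4 v) where

  α-injective : Injective _≡_ _≡_ (α M)
  α-injective {d} {e} eq = trans (sym (α-invol M d)) (trans (cong (α M) eq) (α-invol M e))

  φ-injective : Injective _≡_ _≡_ (φ M)
  φ-injective eq = α-injective (σ-injective eq)

  φ-pred : ∀ {d e} → φ M d ≡ e → d ≡ α M (σ⁻¹ e)
  φ-pred {d} refl = trans (sym (α-invol M d)) (cong (α M) (sym (σ⁴ (α M d))))

  sameFace-refl : ∀ {d} → SameFace M d d
  sameFace-refl = 0 , refl

  sameFace-φ : ∀ d → SameFace M d (φ M d)
  sameFace-φ d = 1 , refl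

  sameFace-trans : ∀ {d e f} → SameFace M d e → SameFace M e f → SameFace M d f
  sameFace-trans {d} (m , refl) (n , refl) = n + m , iter-+ (φ M) n m d

  -- Faces are orbits of a permutation of a finite set, so following φ eventually returns.
  sameFace-sym : ∀ {d e} → SameFace M d e → SameFace M e d
  sameFace-sym {d} (n , refl) =
    let p , period = iter-periodic (φ M) dartCode dartCode-injective φ-injective d
    in n * p , (begin
         iter (φ M) (n * p) (iter (φ M) n d) ≡⟨ iter-+ (φ M) (n * p) n d ⟨
         iter (φ M) (n * p + n) d            ≡⟨ cong (λ m → iter (φ M) m d)
                                                     (trans (+-comm (n * p) n) (sym (*-suc n p))) ⟩
         iter (φ M) (n * suc p) d            ≡⟨ iter-*-period (φ M) period n ⟩
         d                                   ∎)

  reach-trans : ∀ {d e f} → Reach M d e → Reach M e f → Reach M d f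
  reach-trans r here        = r
  reach-trans r (alongE s)  = alongE (reach-trans r s)
  reach-trans r (aroundV s) = aroundV (reach-trans r s)

  reach-sym : ∀ {d e} → Reach M d e → Reach M e d
  reach-sym here                = here
  reach-sym (alongE {e = e} r)  =
    reach-trans (subst (Reach M (α M e)) (α-invol M e) (alongE here)) (reach-sym r)
  reach-sym (aroundV {e = e} r) =
    reach-trans (subst (Reach M (σ e)) (σ⁴ e) (aroundV (aroundV (aroundV here)))) (reach-sym r)

  Covers : Dart v → Dart v → Set
  Covers d₀ d = ∃ λ k → (iter (straight M) k d₀ ≡ d) ⊎ (α M (iter (straight M) k d₀) ≡ d)

  covers-via : ∀ {d₀ z d} k → iter (straight M) k d₀ ≡ z → Covers z d → Covers d₀ d
  covers-via {d₀} k refl (j , hit) =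
    j + k , ⊎-map (trans (iter-+ (straight M) j k d₀))
                  (trans (cong (α M) (iter-+ (straight M) j k d₀))) hit

  connected-fromCircuit : OneStraightAheadCircuit M → Connected M
  connected-fromCircuit (d₀ , covers) d e = reach-trans (reach-sym (fromStart d)) (fromStart e)
    where
    alongWalk : ∀ k → Reach M d₀ (iter (straight M) k d₀)
    alongWalk zero    = here
    alongWalk (suc k) = aroundV (aroundV (alongE (alongWalk k)))
    fromStart : ∀ d → Reach M d₀ d
    fromStart d with covers d
    ... | k , inj₁ refl = alongWalk k
    ... | k , inj₂ refl = alongE (alongWalk k)

  -- One-way reachability of the hubs suffices because SameFace is symmetric.
  hasFaces-fromHubs : ∀ {n} (face : Dart v → Fin n) (hub : Fin n → Dart v) →
                      (∀ ℓ → face (hub ℓ) ≡ ℓ) → (∀ d → face (φ M d) ≡ face d) →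
                      (∀ d → SameFace M d (hub (face d))) → HasFaces M n
  hasFaces-fromHubs face hub face-hub face-φ toHub =
    face , (λ ℓ → hub ℓ , λ eq → trans (cong face eq) (face-hub ℓ)) ,
    λ d e → mk⇔ (sameLabel⇒sameFace d e) sameFace⇒sameLabel
    where
    sameLabel⇒sameFace : ∀ d e → face d ≡ face e → SameFace M d e
    sameLabel⇒sameFace d e eq = sameFace-trans (toHub d)
      (subst (λ ℓ → SameFace M (hub ℓ) e) (sym eq) (sameFace-sym (toHub e)))
    face-iter : ∀ k d → face (iter (φ M) k d) ≡ face d
    face-iter zero    d = refl
    face-iter (suc k) d = trans (face-φ (iter (φ M) k d)) (face-iter k d)
    sameFace⇒sameLabel : ∀ {d e} → SameFace M d e → face d ≡ face e
    sameFace⇒sameLabel {d} (k , refl) = sym (face-iter k d)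

  module Faces {n} (faces : HasFaces M n) where

    face : Dart v → Fin n
    face = proj₁ faces

    sameFace⇒sameLabel : ∀ {d e} → SameFace M d e → face d ≡ face e
    sameFace⇒sameLabel {d} {e} = Equivalence.from (proj₂ (proj₂ faces) d e)

    sameLabel⇒sameFace : ∀ {d e} → face d ≡ face e → SameFace M d e
    sameLabel⇒sameFace {d} {e} = Equivalence.to (proj₂ (proj₂ faces) d e)

    face-surjective : ∀ ℓ → ∃ λ d → face d ≡ ℓ
    face-surjective ℓ = proj₁ (proj₁ (proj₂ faces) ℓ) , proj₂ (proj₁ (proj₂ faces) ℓ) refl

record Within (n : ℕ) (P : ℕ → Set) : Set where
  constructor _,_
  field
    bound : Fin n
    holds : P (toℕ bound)

within? : ∀ {n} {P : ℕ → Set} → (∀ k → Dec (P k)) → Dec (Within n P)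
within? P? = map′ (λ (k , p) → k , p) (λ (k , p) → k , p) (any? (λ k → P? (toℕ k)))

within⇒∃ : ∀ {n} {P : ℕ → Set} → Within n P → ∃ P
within⇒∃ (k , p) = toℕ k , p

_≟ᴰ_ : ∀ {v} → DecidableEquality (Dart v)
_≟ᴰ_ = ≡-dec _≟_ _≟_

∀-dart? : ∀ {v} {P : Dart v → Set} → Decidable P → Dec (∀ d → P d)
∀-dart? P? = map′ (λ all d → all (proj₁ d) (proj₂ d)) (λ all x i → all (x , i))
                  (all? λ x → all? λ i → P? (x , i))

-- Row x of the table lists the far ends of the four edges at x in rotation order. Faces are
-- labelled by the first of faceReps reached along φ.
module Certificate {v : ℕ} (table : Vec (Vec (Dart v) 4) v) (faceReps : Vec (Dart v) (v + 2))
                   (d₀ : Dart v) where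

  edge : Dart v → Dart v
  edge (x , i) = lookup (lookup table x) i

  involutive? : Dec (∀ d → edge (edge d) ≡ d)
  involutive? = ∀-dart? λ d → edge (edge d) ≟ᴰ d

  fixpointFree? : Dec (∀ d → edge d ≢ d)
  fixpointFree? = ∀-dart? λ d → ¬? (edge d ≟ᴰ d)

  module Checked {inv : True involutive?} {fix : True fixpointFree?} where

    map : Map4 v
    map = record { α = edge ; α-invol = toWitness inv ; α-nofix = toWitness fix }

    loopless? : Dec (Loopless map)
    loopless? = ∀-dart? λ d → ¬? (vertex (edge d) ≟ vertex d)

    noMultiEdges? : Dec (NoMultiEdges map)
    noMultiEdges? = all? λ x → all? λ i → all? λ j →
                    (vertex (edge (x , i)) ≟ vertex (edge (x , j))) →-dec (i ≟ j)

    circuit? : Dec (∀ d → Within (v + v) λ k →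
                      (iter (straight map) k d₀ ≡ d) ⊎ (edge (iter (straight map) k d₀) ≡ d))
    circuit? = ∀-dart? λ d → within? λ k →
               (iter (straight map) k d₀ ≟ᴰ d) ⊎-dec (edge (iter (straight map) k d₀) ≟ᴰ d)

    ReachesRep : Dart v → Set
    ReachesRep d = ∃ λ c → Within 6 λ k → iter (φ map) k d ≡ lookup faceReps c

    reachesRep? : Dec (∀ d → ReachesRep d)
    reachesRep? = ∀-dart? λ d → any? λ c → within? λ k → iter (φ map) k d ≟ᴰ lookup faceReps c

    module Labelled (reach : ∀ d → ReachesRep d) where

      face : Dart v → Fin (v + 2)
      face d = proj₁ (reach d)

      labelling? : Dec ((∀ d → face (φ map d) ≡ face d) × (∀ c → face (lookup faceReps c) ≡ c))
      labelling? = (∀-dart? λ d → face (φ map d) ≟ face d)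
                   ×-dec (all? λ c → face (lookup faceReps c) ≟ c)

      hasFaces : True labelling? → HasFaces map (v + 2)
      hasFaces ok = hasFaces-fromHubs map face (lookup faceReps) (proj₂ (toWitness ok))
                      (proj₁ (toWitness ok)) (λ d → within⇒∃ (proj₂ (reach d)))

    luneFreeKnotGraph : {_ : True loopless?} {_ : True noMultiEdges?} {_ : True circuit?}
                        {reach : True reachesRep?}
                        {_ : True (Labelled.labelling? (toWitness reach))} →
                        LuneFreeKnotGraph map
    luneFreeKnotGraph {l} {m} {c} {r} {f} =
      (connected-fromCircuit map circuit , Labelled.hasFaces (toWitness r) f) ,
      toWitness l , toWitness m , circuit
      where
      circuit : OneStraightAheadCircuit map
      circuit = d₀ , λ d → within⇒∃ (toWitness c d)

siteDart : ∀ {u} → Fin 6 → Dart (4 + u)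
siteDart = lookup ((# 0 , # 0) ∷ (# 1 , # 0) ∷ (# 1 , # 1)
                 ∷ (# 2 , # 3) ∷ (# 2 , # 2) ∷ (# 3 , # 2) ∷ [])

partner : Fin 6 → Fin 6
partner = lookup (# 3 ∷ # 4 ∷ # 5 ∷ # 0 ∷ # 1 ∷ # 2 ∷ [])

-- Edges 0–2, 1–2 and 1–3, placed so that consecutive edges of the path 0–2–1–3 are adjacent
-- in the rotations at 2 and at 1.
Site : ∀ {u} → Map4 (4 + u) → Set
Site M = ∀ k → α M (siteDart k) ≡ siteDart (partner k)

site? : ∀ {u} (M : Map4 (4 + u)) → Dec (Site M)
site? M = all? λ k → α M (siteDart k) ≟ᴰ siteDart (partner k)

SitedKnotGraph : ℕ → Set
SitedKnotGraph u = Σ (Map4 (4 + u)) λ M → LuneFreeKnotGraph M × Site M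

siteDart-injective : ∀ {u} → Injective _≡_ _≡_ (siteDart {u})
siteDart-injective {x = k} {k′} =
  from-yes (all? λ k → all? λ k′ → (siteDart k ≟ᴰ siteDart k′) →-dec (k ≟ k′)) k k′

exit : ∀ {u} → Fin 6 → Dart (4 + u)
exit = lookup ((# 2 , # 0) ∷ (# 0 , # 1) ∷ (# 3 , # 3)
             ∷ (# 0 , # 1) ∷ (# 3 , # 3) ∷ (# 1 , # 2) ∷ [])

module _ {u : ℕ} where

  Uncut : Dart (4 + u) → Set
  Uncut a = ¬ ∃ λ k → siteDart k ≡ a

  siteDec : ∀ (a : Dart (4 + u)) → Dec (∃ λ k → siteDart k ≡ a)
  siteDec a = any? λ k → siteDart k ≟ᴰ a

  siteView : ∀ (a : Dart (4 + u)) → (∃ λ k → siteDart k ≡ a) ⊎ Uncut a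
  siteView a = toSum (siteDec a)

  caseSite : ∀ {a : Dart (4 + u)} {B : Set} →
             Dec (∃ λ k → siteDart k ≡ a) → (Fin 6 → B) → B → B
  caseSite (yes (k , _)) f b = f k
  caseSite (no _)        f b = b

  bySite : ∀ {B : Set} → (Fin 6 → B) → (Dart (4 + u) → B) → Dart (4 + u) → B
  bySite f g a = caseSite (siteDec a) f (g a)

  bySite-view : ∀ {B : Set} (f : Fin 6 → B) (g : Dart (4 + u) → B) (a : Dart (4 + u)) →
                (∃ λ k → siteDart k ≡ a × bySite f g a ≡ f k) ⊎ (Uncut a × bySite f g a ≡ g a)
  bySite-view f g a = caseSite-view (siteDec a)
    where
    caseSite-view : (s : Dec (∃ λ k → siteDart k ≡ a)) →
                    (∃ λ k → siteDart k ≡ a × caseSite s f (g a) ≡ f k)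
                    ⊎ (Uncut a × caseSite s f (g a) ≡ g a)
    caseSite-view (yes (k , e)) = inj₁ (k , e , refl)
    caseSite-view (no ¬site)    = inj₂ (¬site , refl)

  bySite-uncut : ∀ {B : Set} {f : Fin 6 → B} {g : Dart (4 + u) → B} {a : Dart (4 + u)} →
                 Uncut a → bySite f g a ≡ g a
  bySite-uncut {f = f} {g} {a} ua with bySite-view f g a
  ... | inj₁ (k , e , _) = ⊥-elim (ua (k , e))
  ... | inj₂ (_ , eq)    = eq

  -- As φ (siteDart k) = σ (siteDart (partner k)) in a map with the site, this says that the face
  -- through siteDart k leaves the site at exit k after one or two steps.
  ExitPath : Fin 6 → Set
  ExitPath k = (σ (siteDart {u} (partner k)) ≡ exit k)
             ⊎ ∃ λ k′ → σ (siteDart {u} (partner k)) ≡ siteDart k′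
                      × σ (siteDart {u} (partner k′)) ≡ exit k × exit {u} k′ ≡ exit k

  exit-path : ∀ k → ExitPath k
  exit-path = from-yes (all? λ k → (σ (siteDart (partner k)) ≟ᴰ exit k) ⊎-dec any? λ k′ →
    (σ (siteDart (partner k)) ≟ᴰ siteDart k′) ×-dec (σ (siteDart (partner k′)) ≟ᴰ exit k)
    ×-dec (exit {u} k′ ≟ᴰ exit k))

  exit-uncut : ∀ k → Uncut (exit k)
  exit-uncut = from-yes (all? λ k → ¬? (siteDec (exit k)))

-- The darts at the six new vertices, and the six old ends of the cut site edges.
data Gadget : Set where
  new : Fin 6 → Fin 4 → Gadget
  cut : Fin 6 → Gadget

∀-gadget? : {P : Gadget → Set} → Decidable P → Dec (∀ g → P g)
∀-gadget? P? = map′ (λ { (n , c) (new x i) → n x i ; (n , c) (cut k) → c k })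
                    (λ all → (λ x i → all (new x i)) , (λ k → all (cut k)))
                    ((all? λ x → all? λ i → P? (new x i)) ×-dec (all? λ k → P? (cut k)))

gadgetEdge : Gadget → Gadget
gadgetEdge (new x i) = lookup (lookup newEdges x) i
  where
  newEdges : Vec (Vec Gadget 4) 6
  newEdges =
      (new (# 2) (# 3) ∷ new (# 1) (# 3) ∷ cut (# 1)       ∷ cut (# 0)       ∷ [])
    ∷ (new (# 2) (# 2) ∷ new (# 3) (# 2) ∷ cut (# 2)       ∷ new (# 0) (# 1) ∷ [])
    ∷ (new (# 4) (# 3) ∷ new (# 3) (# 3) ∷ new (# 1) (# 0) ∷ new (# 0) (# 0) ∷ [])
    ∷ (new (# 4) (# 2) ∷ new (# 5) (# 2) ∷ new (# 1) (# 1) ∷ new (# 2) (# 1) ∷ [])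
    ∷ (cut (# 3)       ∷ new (# 5) (# 3) ∷ new (# 3) (# 0) ∷ new (# 2) (# 0) ∷ [])
    ∷ (cut (# 4)       ∷ cut (# 5)       ∷ new (# 3) (# 1) ∷ new (# 4) (# 1) ∷ [])
    ∷ []
gadgetEdge (cut k) = lookup cutEdges k
  where
  cutEdges : Vec Gadget 6
  cutEdges = new (# 0) (# 3) ∷ new (# 0) (# 2) ∷ new (# 1) (# 2)
           ∷ new (# 4) (# 0) ∷ new (# 5) (# 0) ∷ new (# 5) (# 1) ∷ []

-- A face of the spliced map is named either by one of the six faces inside the gadget (inj₁)
-- or by an uncut dart of the old map whose face it continues (inj₂).
FaceName : ℕ → Set
FaceName u = Fin 6 ⊎ Dart (4 + u)

_≟ᶠ_ : ∀ {u} → DecidableEquality (FaceName u)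
_≟ᶠ_ = ≡-dec-⊎ _≟_ _≟ᴰ_

gadgetFace : ∀ {u} → Gadget → FaceName u
gadgetFace (new x i) = lookup (lookup newFaces x) i
  where
  newFaces : Vec (Vec (FaceName _) 4) 6
  newFaces =
      (inj₂ (# 2 , # 0) ∷ inj₁ (# 0)       ∷ inj₁ (# 1)       ∷ inj₂ (# 0 , # 1) ∷ [])
    ∷ (inj₁ (# 0)       ∷ inj₁ (# 2)       ∷ inj₂ (# 1 , # 2) ∷ inj₁ (# 1)       ∷ [])
    ∷ (inj₂ (# 2 , # 0) ∷ inj₁ (# 3)       ∷ inj₁ (# 2)       ∷ inj₁ (# 0)       ∷ [])
    ∷ (inj₁ (# 3)       ∷ inj₁ (# 4)       ∷ inj₂ (# 1 , # 2) ∷ inj₁ (# 2)       ∷ [])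
    ∷ (inj₂ (# 2 , # 0) ∷ inj₁ (# 5)       ∷ inj₁ (# 4)       ∷ inj₁ (# 3)       ∷ [])
    ∷ (inj₁ (# 5)       ∷ inj₂ (# 3 , # 3) ∷ inj₂ (# 1 , # 2) ∷ inj₁ (# 4)       ∷ [])
    ∷ []
gadgetFace (cut k) = lookup cutFaces k
  where
  cutFaces : Vec (FaceName _) 6
  cutFaces = inj₂ (# 2 , # 0) ∷ inj₂ (# 0 , # 1) ∷ inj₁ (# 1)
           ∷ inj₁ (# 5)       ∷ inj₂ (# 3 , # 3) ∷ inj₂ (# 1 , # 2) ∷ []

newFaceHub : Fin 6 → Gadget
newFaceHub = lookup (new (# 0) (# 1) ∷ new (# 0) (# 2) ∷ new (# 1) (# 1)
                   ∷ new (# 2) (# 1) ∷ new (# 3) (# 1) ∷ new (# 4) (# 1) ∷ [])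

module Splice {u : ℕ} (M : Map4 (4 + u)) (site : Site M) (G : LuneFreeKnotGraph M) where

  V : ℕ
  V = 4 + u

  faces : HasFaces M (V + 2)
  faces = proj₂ (proj₁ G)

  loopless : Loopless M
  loopless = proj₁ (proj₂ G)

  noMultiEdges : NoMultiEdges M
  noMultiEdges = proj₁ (proj₂ (proj₂ G))

  circuit : OneStraightAheadCircuit M
  circuit = proj₂ (proj₂ (proj₂ G))

  open Faces M faces

  Dart′ : Set
  Dart′ = Dart (6 + V)

  old : Dart V → Dart′
  old (y , i) = (6 ↑ʳ y , i)

  old-injective : Injective _≡_ _≡_ old
  old-injective {y , i} {y′ , .i} refl with refl ← ↑ʳ-injective 6 y y′ refl = refl

  ⟦_⟧ : Gadget → Dart′
  ⟦ new x i ⟧ = (x ↑ˡ V , i)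
  ⟦ cut k ⟧   = old (siteDart k)

  α′ : Dart′ → Dart′
  α′ (x , i) with splitAt 6 x
  ... | inj₁ y = ⟦ gadgetEdge (new y i) ⟧
  ... | inj₂ y = bySite (λ k → ⟦ gadgetEdge (cut k) ⟧) (λ a → old (α M a)) (y , i)

  data View : Dart′ → Set where
    gadget : ∀ g → View ⟦ g ⟧
    kept   : ∀ {a} → Uncut a → View (old a)

  view : ∀ d → View d
  view (x , i) with splitAt 6 x in eq
  ... | inj₁ y = subst (λ x → View (x , i)) (splitAt⁻¹-↑ˡ eq) (gadget (new y i))
  ... | inj₂ y with siteDec (y , i)
  ...   | yes (k , e) = subst View (trans (cong old e) (cong (_, i) (splitAt⁻¹-↑ʳ eq))) (gadget (cut k))
  ...   | no ua       = subst (λ x → View (x , i)) (splitAt⁻¹-↑ʳ eq) (kept ua)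

  α-uncut : ∀ {a : Dart V} → Uncut a → Uncut (α M a)
  α-uncut {a} ua (k , e) = ua (partner k , trans (sym (site k)) (trans (cong (α M) e) (α-invol M a)))

  α′-kept : ∀ {a : Dart V} → Uncut a → α′ (old a) ≡ old (α M a)
  α′-kept ua = bySite-uncut {f = λ k → ⟦ gadgetEdge (cut k) ⟧} {g = λ a → old (α M a)} ua

  gadget-involutive : ∀ g → α′ (α′ ⟦ g ⟧) ≡ ⟦ g ⟧
  gadget-involutive = from-yes (∀-gadget? λ g → α′ (α′ ⟦ g ⟧) ≟ᴰ ⟦ g ⟧)

  gadget-fixpointFree : ∀ g → α′ ⟦ g ⟧ ≢ ⟦ g ⟧
  gadget-fixpointFree = from-yes (∀-gadget? λ g → ¬? (α′ ⟦ g ⟧ ≟ᴰ ⟦ g ⟧))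

  α′-involutive : ∀ d → α′ (α′ d) ≡ d
  α′-involutive d with view d
  ... | gadget g    = gadget-involutive g
  ... | kept {a} ua = begin
    α′ (α′ (old a))   ≡⟨ cong α′ (α′-kept ua) ⟩
    α′ (old (α M a))  ≡⟨ α′-kept (α-uncut ua) ⟩
    old (α M (α M a)) ≡⟨ cong old (α-invol M a) ⟩
    old a             ∎

  α′-fixpointFree : ∀ d → α′ d ≢ d
  α′-fixpointFree d with view d
  ... | gadget g    = gadget-fixpointFree g
  ... | kept {a} ua = λ eq → α-nofix M a (old-injective (trans (sym (α′-kept ua)) eq))

  M′ : Map4 (6 + V)
  M′ = record { α = α′ ; α-invol = α′-involutive ; α-nofix = α′-fixpointFree }

  IsNew : Fin (6 + V) → Set
  IsNew x = ∃ λ (y : Fin 6) → x ≡ y ↑ˡ V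

  new≢old : ∀ (y : Fin 6) (z : Fin V) → y ↑ˡ V ≢ 6 ↑ʳ z
  new≢old y z eq with () ← trans (sym (splitAt-↑ˡ 6 y V)) (cong (splitAt 6) eq)

  gadget-loopless : ∀ g → vertex (α′ ⟦ g ⟧) ≢ vertex ⟦ g ⟧
  gadget-loopless = from-yes (∀-gadget? λ g → ¬? (vertex (α′ ⟦ g ⟧) ≟ vertex ⟦ g ⟧))

  gadget-edge-new : ∀ g → IsNew (vertex ⟦ g ⟧) ⊎ IsNew (vertex (α′ ⟦ g ⟧))
  gadget-edge-new =
    from-yes (∀-gadget? λ g → new? (vertex ⟦ g ⟧) ⊎-dec new? (vertex (α′ ⟦ g ⟧)))
    where
    new? : ∀ (x : Fin (6 + V)) → Dec (IsNew x)
    new? x = any? λ y → x ≟ y ↑ˡ V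

  gadget-noMultiEdges : ∀ g g′ → vertex ⟦ g ⟧ ≡ vertex ⟦ g′ ⟧ →
                        vertex (α′ ⟦ g ⟧) ≡ vertex (α′ ⟦ g′ ⟧) →
                        rotation ⟦ g ⟧ ≡ rotation ⟦ g′ ⟧
  gadget-noMultiEdges = from-yes (∀-gadget? λ g → ∀-gadget? λ g′ →
    (vertex ⟦ g ⟧ ≟ vertex ⟦ g′ ⟧) →-dec
    (vertex (α′ ⟦ g ⟧) ≟ vertex (α′ ⟦ g′ ⟧)) →-dec
    (rotation ⟦ g ⟧ ≟ rotation ⟦ g′ ⟧))

  loopless′ : Loopless M′
  loopless′ d with view d
  ... | gadget g    = gadget-loopless g
  ... | kept {a} ua = λ eq →
    loopless a (↑ʳ-injective 6 _ _ (trans (cong vertex (sym (α′-kept ua))) eq))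

  gadget≢kept : ∀ g {a} → Uncut a → vertex ⟦ g ⟧ ≡ vertex (old a) →
                vertex (α′ ⟦ g ⟧) ≢ vertex (α′ (old a))
  gadget≢kept g ua same =
    [ (λ (y , e) _  → new≢old y _ (trans (sym e) same))
    , (λ (y , e) eq → new≢old y _ (trans (sym e) (trans eq (cong vertex (α′-kept ua))))) ]′
    (gadget-edge-new g)

  α′-sameNeighbour : ∀ d e → vertex d ≡ vertex e → vertex (α′ d) ≡ vertex (α′ e) →
                     rotation d ≡ rotation e
  α′-sameNeighbour d e with view d | view e
  ... | gadget g | gadget g′ = gadget-noMultiEdges g g′
  ... | gadget g | kept ua   = λ same eq → ⊥-elim (gadget≢kept g ua same eq)
  ... | kept ua  | gadget g  = λ same eq → ⊥-elim (gadget≢kept g ua (sym same) (sym eq))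
  ... | kept {x , i} ua | kept {y , j} ub = λ same eq → noMultiEdges x i j (neighbours same eq)
    where
    neighbours : 6 ↑ʳ x ≡ 6 ↑ʳ y → vertex (α′ (old (x , i))) ≡ vertex (α′ (old (y , j))) →
                 vertex (α M (x , i)) ≡ vertex (α M (x , j))
    neighbours same eq with refl ← ↑ʳ-injective 6 x y same = ↑ʳ-injective 6 _ _
      (trans (cong vertex (sym (α′-kept ua))) (trans eq (cong vertex (α′-kept ub))))

  noMultiEdges′ : NoMultiEdges M′
  noMultiEdges′ x i j = α′-sameNeighbour (x , i) (x , j) refl

  φ-site : ∀ k → φ M (siteDart k) ≡ σ (siteDart (partner k))
  φ-site k = cong σ (site k)

  φ′-kept : ∀ {a} → Uncut a → φ M′ (old a) ≡ old (φ M a)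
  φ′-kept ua = cong σ (α′-kept ua)

  sameFace-exit : ∀ k → SameFace M (siteDart k) (exit k)
  sameFace-exit k =
    [ (λ e → 1 , trans (φ-site k) e)
    , (λ (k′ , e , e′ , _) →
         2 , trans (cong (φ M) (trans (φ-site k) e)) (trans (φ-site k′) e′)) ]′
    (exit-path k)

  entered-uncut : ∀ {a b : Dart V} → Uncut a → φ M a ≡ b → Uncut (σ⁻¹ b)
  entered-uncut ua e = subst Uncut (trans (cong (α M) (φ-pred M e)) (α-invol M _)) (α-uncut ua)

  faceName : Dart′ → FaceName u
  faceName (x , i) with splitAt 6 x
  ... | inj₁ y = gadgetFace (new y i)
  ... | inj₂ y = bySite (λ k → gadgetFace (cut k)) inj₂ (y , i)

  faceName-kept : ∀ {a} → Uncut a → faceName (old a) ≡ inj₂ a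
  faceName-kept ua = bySite-uncut {f = λ k → gadgetFace (cut k)} {g = inj₂} ua

  hubOf : FaceName u → Dart′
  hubOf = [ (λ c → ⟦ newFaceHub c ⟧) , old ]′

  UncutName : FaceName u → Set
  UncutName = [ (λ _ → ⊤) , Uncut ]′

  gadget-faceName-φ : ∀ g → faceName (φ M′ ⟦ g ⟧) ≡ faceName ⟦ g ⟧
  gadget-faceName-φ = from-yes (∀-gadget? λ g → faceName (φ M′ ⟦ g ⟧) ≟ᶠ faceName ⟦ g ⟧)

  gadget-reachesHub : ∀ g → Within 6 λ j → iter (φ M′) j ⟦ g ⟧ ≡ hubOf (faceName ⟦ g ⟧)
  gadget-reachesHub = from-yes (∀-gadget? λ g → within? {6} λ j →
                        iter (φ M′) j ⟦ g ⟧ ≟ᴰ hubOf (faceName ⟦ g ⟧))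

  gadget-uncutName : ∀ g → UncutName (faceName ⟦ g ⟧)
  gadget-uncutName = from-yes (∀-gadget? λ g → uncutName? (faceName ⟦ g ⟧))
    where
    uncutName? : ∀ n → Dec (UncutName n)
    uncutName? (inj₁ _) = yes tt
    uncutName? (inj₂ a) = ¬? (siteDec a)

  newFaceHub-name : ∀ c → faceName ⟦ newFaceHub c ⟧ ≡ inj₁ c
  newFaceHub-name = from-yes (all? λ c → faceName ⟦ newFaceHub c ⟧ ≟ᶠ inj₁ c)

  entered-name : ∀ k → Uncut {u} (σ⁻¹ (siteDart k)) → faceName ⟦ cut k ⟧ ≡ inj₂ (exit k)
  entered-name = from-yes (all? λ k →
                   ¬? (siteDec (σ⁻¹ (siteDart k))) →-dec (faceName ⟦ cut k ⟧ ≟ᶠ inj₂ (exit k)))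

  reachesName : ∀ d → SameFace M′ d (hubOf (faceName d))
  reachesName d with view d
  ... | gadget g    = within⇒∃ (gadget-reachesHub g)
  ... | kept {a} ua =
    subst (λ n → SameFace M′ (old a) (hubOf n)) (sym (faceName-kept ua)) (sameFace-refl M′)

  uncutName : ∀ d → UncutName (faceName d)
  uncutName d with view d
  ... | gadget g = gadget-uncutName g
  ... | kept ua  = subst UncutName (sym (faceName-kept ua)) ua

  entered-sameFace : ∀ k → Uncut {u} (σ⁻¹ (siteDart k)) → SameFace M′ ⟦ cut k ⟧ (old (exit k))
  entered-sameFace k entered =
    subst (λ n → SameFace M′ ⟦ cut k ⟧ (hubOf n)) (entered-name k entered) (reachesName ⟦ cut k ⟧)

  -- Walking around a face of M from an uncut dart, the spliced map follows along the kept darts,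
  -- and whenever the walk enters the site it re-emerges at the corresponding exit.
  kept-sameFace : ∀ {a b} → Uncut a → Uncut b → SameFace M a b → SameFace M′ (old a) (old b)
  kept-sameFace {a} ua ub (n , refl) = proj₁ (walk n) ub
    where
    Reached : Dart V → Set
    Reached c = SameFace M′ (old a) (old c)

    Walk : Dart V → Set
    Walk c = (Uncut c → Reached c) × (∀ k → c ≡ siteDart k → Reached (exit k))

    step : ∀ c → Walk c → Walk (φ M c)
    step c (toC , toExit) = [ fromSite , fromKept ]′ (siteView c)
      where
      fromKept : Uncut c → Walk (φ M c)
      fromKept uc = (λ _ → toφc) , λ k e →
        sameFace-trans M′ toφc (subst (λ d → SameFace M′ (old d) (old (exit k))) (sym e)
                                      (entered-sameFace k (entered-uncut uc e)))
        where
        toφc : Reached (φ M c)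
        toφc = sameFace-trans M′ (toC uc) (1 , φ′-kept uc)

      fromSite : (∃ λ k → siteDart k ≡ c) → Walk (φ M c)
      fromSite (k , e) = [ leaves , staysIn ]′ (exit-path k)
        where
        φc : φ M c ≡ σ (siteDart (partner k))
        φc = trans (cong (φ M) (sym e)) (φ-site k)
        toE : Reached (exit k)
        toE = toExit k (sym e)
        leaves : σ (siteDart (partner k)) ≡ exit k → Walk (φ M c)
        leaves p = (λ _ → subst Reached (sym (trans φc p)) toE)
                 , (λ k″ e″ → ⊥-elim (exit-uncut k (k″ , sym (trans (sym (trans φc p)) e″))))
        staysIn : (∃ λ k′ → σ (siteDart (partner k)) ≡ siteDart k′
                          × σ (siteDart (partner k′)) ≡ exit k × exit {u} k′ ≡ exit k) →
                  Walk (φ M c)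
        staysIn (k′ , q , _ , r) =
          (λ uφc → ⊥-elim (uφc (k′ , sym (trans φc q)))) ,
          (λ k″ e″ → subst (λ k → Reached (exit k))
                           (siteDart-injective {u} {k′} {k″} (trans (sym (trans φc q)) e″))
                           (subst Reached (sym r) toE))

    walk : ∀ n → Walk (iter (φ M) n a)
    walk zero    = (λ _ → sameFace-refl M′) , (λ k e → ⊥-elim (ua (k , sym e)))
    walk (suc n) = step (iter (φ M) n a) (walk n)

  uncutRep : Dart V → Dart V
  uncutRep = bySite exit id

  uncutRep-uncut : ∀ a → Uncut (uncutRep a)
  uncutRep-uncut a = [ (λ (k , _ , eq) → subst Uncut (sym eq) (exit-uncut k))
                     , (λ (ua , eq) → subst Uncut (sym eq) ua) ]′ (bySite-view exit id a)

  sameFace-uncutRep : ∀ a → SameFace M a (uncutRep a)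
  sameFace-uncutRep a = [ (λ (k , e , eq) → subst₂ (SameFace M) e (sym eq) (sameFace-exit k))
                        , (λ (_ , eq) → subst (SameFace M a) (sym eq) (sameFace-refl M)) ]′
                        (bySite-view exit id a)

  oldHub : Fin (V + 2) → Dart V
  oldHub L = uncutRep (proj₁ (face-surjective L))

  oldHub-uncut : ∀ L → Uncut (oldHub L)
  oldHub-uncut L = uncutRep-uncut (proj₁ (face-surjective L))

  face-oldHub : ∀ L → face (oldHub L) ≡ L
  face-oldHub L = trans (sym (sameFace⇒sameLabel (sameFace-uncutRep _))) (proj₂ (face-surjective L))

  label : FaceName u → Fin (6 + (V + 2))
  label = [ _↑ˡ (V + 2) , (λ a → 6 ↑ʳ face a) ]′

  hubOfSplit : Fin 6 ⊎ Fin (V + 2) → Dart′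
  hubOfSplit = [ (λ c → ⟦ newFaceHub c ⟧) , (λ L → old (oldHub L)) ]′

  hub′ : Fin (6 + (V + 2)) → Dart′
  hub′ ℓ = hubOfSplit (splitAt 6 ℓ)

  label-hub′ : ∀ ℓ → label (faceName (hub′ ℓ)) ≡ ℓ
  label-hub′ ℓ = trans (labelSplit (splitAt 6 ℓ)) (join-splitAt 6 (V + 2) ℓ)
    where
    labelSplit : ∀ s → label (faceName (hubOfSplit s)) ≡ join 6 (V + 2) s
    labelSplit (inj₁ c) = cong label (newFaceHub-name c)
    labelSplit (inj₂ L) =
      trans (cong label (faceName-kept (oldHub-uncut L))) (cong (6 ↑ʳ_) (face-oldHub L))

  reachesHub′ : ∀ d → SameFace M′ d (hub′ (label (faceName d)))
  reachesHub′ d = toHub (faceName d) (reachesName d) (uncutName d)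
    where
    toHub : ∀ n → SameFace M′ d (hubOf n) → UncutName n → SameFace M′ d (hub′ (label n))
    toHub (inj₁ c) r _  = subst (λ s → SameFace M′ d (hubOfSplit s)) (sym (splitAt-↑ˡ 6 c (V + 2))) r
    toHub (inj₂ a) r ua = sameFace-trans M′ r
      (kept-sameFace ua (oldHub-uncut (face a)) (sameLabel⇒sameFace (sym (face-oldHub (face a)))))

  faceName-φ-kept : ∀ {a} → Uncut a → ∃ λ b → faceName (old (φ M a)) ≡ inj₂ b × SameFace M a b
  faceName-φ-kept {a} ua =
    [ viaSite , (λ uφa → φ M a , faceName-kept uφa , sameFace-φ M a) ]′ (siteView (φ M a))
    where
    viaSite : (∃ λ k → siteDart k ≡ φ M a) →
              ∃ λ b → faceName (old (φ M a)) ≡ inj₂ b × SameFace M a b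
    viaSite (k , e) = exit k
                    , trans (cong (faceName ∘ old) (sym e)) (entered-name k (entered-uncut ua (sym e)))
                    , sameFace-trans M (1 , sym e) (sameFace-exit k)

  label-φ : ∀ d → label (faceName (φ M′ d)) ≡ label (faceName d)
  label-φ d with view d
  ... | gadget g    = cong label (gadget-faceName-φ g)
  ... | kept {a} ua =
    let b , name , a~b = faceName-φ-kept ua in begin
      label (faceName (φ M′ (old a))) ≡⟨ cong (label ∘ faceName) (φ′-kept ua) ⟩
      label (faceName (old (φ M a)))  ≡⟨ cong label name ⟩
      6 ↑ʳ face b                     ≡⟨ cong (6 ↑ʳ_) (sameFace⇒sameLabel a~b) ⟨
      6 ↑ʳ face a                     ≡⟨ cong label (faceName-kept ua) ⟨
      label (faceName (old a))        ∎

  hasFaces′ : HasFaces M′ (6 + (V + 2))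
  hasFaces′ = hasFaces-fromHubs M′ (label ∘ faceName) hub′ label-hub′ label-φ reachesHub′

  straight′-kept : ∀ {a} → Uncut a → straight M′ (old a) ≡ old (straight M a)
  straight′-kept ua = cong across (α′-kept ua)

  cut-straight : ∀ k → Within 6 λ j →
                 iter (straight M′) j ⟦ cut k ⟧ ≡ old (across (siteDart (partner k)))
  cut-straight = from-yes (all? λ k → within? {6} λ j →
                   iter (straight M′) j ⟦ cut k ⟧ ≟ᴰ old (across (siteDart (partner k))))

  straight-step : ∀ z → ∃ λ j → iter (straight M′) j (old z) ≡ old (straight M z)
  straight-step z = [ throughGadget , (λ ua → 1 , straight′-kept ua) ]′ (siteView z)
    where
    throughGadget : (∃ λ k → siteDart k ≡ z) →
                    ∃ λ j → iter (straight M′) j (old z) ≡ old (straight M z)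
    throughGadget (k , refl) = let j , reach = within⇒∃ (cut-straight k) in
                               j , trans reach (cong (old ∘ across) (sym (site k)))

  CoversWithin : ℕ → Dart′ → Dart′ → Set
  CoversWithin n z d = Within n λ j →
    (iter (straight M′) j z ≡ d) ⊎ (α′ (iter (straight M′) j z) ≡ d)

  gadget-covered : ∀ g → ∃ λ k → CoversWithin 5 ⟦ cut k ⟧ ⟦ g ⟧
                               × CoversWithin 5 ⟦ cut (partner k) ⟧ ⟦ g ⟧
  gadget-covered = from-yes (∀-gadget? λ g → any? λ k →
                     covers? ⟦ cut k ⟧ ⟦ g ⟧ ×-dec covers? ⟦ cut (partner k) ⟧ ⟦ g ⟧)
    where
    covers? : ∀ z d → Dec (CoversWithin 5 z d)
    covers? z d = within? λ j →
      (iter (straight M′) j z ≟ᴰ d) ⊎-dec (α′ (iter (straight M′) j z) ≟ᴰ d)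

  d₀ : Dart V
  d₀ = proj₁ circuit

  walk : ∀ n → ∃ λ j → iter (straight M′) j (old d₀) ≡ old (iter (straight M) n d₀)
  walk n = iter-simulate (straight M′) old (straight M) straight-step n d₀

  kept-covered : ∀ {a} → Uncut a → Covers M′ (old d₀) (old a)
  kept-covered {a} ua with proj₂ circuit a
  ... | n , inj₁ e = let j , reach = walk n in j , inj₁ (trans reach (cong old e))
  ... | n , inj₂ e = let j , reach = walk n in
                     j , inj₂ (trans (cong α′ reach) (trans (α′-kept uWn) (cong old e)))
    where
    uWn : Uncut (iter (straight M) n d₀)
    uWn = subst Uncut (trans (sym (cong (α M) e)) (α-invol M _)) (α-uncut ua)

  -- The circuit of M traverses every site edge, so it passes one of its two cut ends.
  cut-covered : ∀ {d} k → CoversWithin 5 ⟦ cut k ⟧ d → CoversWithin 5 ⟦ cut (partner k) ⟧ d →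
                Covers M′ (old d₀) d
  cut-covered k fromCut fromPartner with proj₂ circuit (siteDart k)
  ... | n , inj₁ e = let j , reach = walk n in
                     covers-via M′ j (trans reach (cong old e)) (within⇒∃ fromCut)
  ... | n , inj₂ e = let j , reach = walk n in
                     covers-via M′ j (trans reach (cong old Wn≡partner)) (within⇒∃ fromPartner)
    where
    Wn≡partner : iter (straight M) n d₀ ≡ siteDart (partner k)
    Wn≡partner = trans (sym (α-invol M _)) (trans (cong (α M) e) (site k))

  circuit′ : OneStraightAheadCircuit M′
  circuit′ = old d₀ , covers′
    where
    covers′ : ∀ d → Covers M′ (old d₀) d
    covers′ d with view d
    ... | kept ua  = kept-covered ua
    ... | gadget g = let k , fromCut , fromPartner = gadget-covered g in
                     cut-covered k fromCut fromPartner

  spliced : SitedKnotGraph (6 + u)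
  spliced = M′
          , ((connected-fromCircuit M′ circuit′ , hasFaces′) , loopless′ , noMultiEdges′ , circuit′)
          , from-yes (site? M′)

graph8 : Vec (Vec (Dart 8) 4) 8
graph8 =
    ((# 2 , # 3) ∷ (# 6 , # 3) ∷ (# 5 , # 3) ∷ (# 4 , # 0) ∷ [])
  ∷ ((# 2 , # 2) ∷ (# 3 , # 2) ∷ (# 7 , # 0) ∷ (# 6 , # 0) ∷ [])
  ∷ ((# 4 , # 3) ∷ (# 3 , # 3) ∷ (# 1 , # 0) ∷ (# 0 , # 0) ∷ [])
  ∷ ((# 4 , # 2) ∷ (# 7 , # 1) ∷ (# 1 , # 1) ∷ (# 2 , # 1) ∷ [])
  ∷ ((# 0 , # 3) ∷ (# 5 , # 2) ∷ (# 3 , # 0) ∷ (# 2 , # 0) ∷ [])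
  ∷ ((# 6 , # 2) ∷ (# 7 , # 2) ∷ (# 4 , # 1) ∷ (# 0 , # 2) ∷ [])
  ∷ ((# 1 , # 3) ∷ (# 7 , # 3) ∷ (# 5 , # 0) ∷ (# 0 , # 1) ∷ [])
  ∷ ((# 1 , # 2) ∷ (# 3 , # 1) ∷ (# 5 , # 1) ∷ (# 6 , # 1) ∷ [])
  ∷ []

faces8 : Vec (Dart 8) 10
faces8 =
    (# 0 , # 0) ∷ (# 0 , # 1) ∷ (# 0 , # 2) ∷ (# 0 , # 3) ∷ (# 1 , # 1)
  ∷ (# 1 , # 2) ∷ (# 1 , # 3) ∷ (# 2 , # 1) ∷ (# 3 , # 1) ∷ (# 5 , # 1) ∷ []

graph9 : Vec (Vec (Dart 9) 4) 9
graph9 =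
    ((# 2 , # 3) ∷ (# 1 , # 3) ∷ (# 7 , # 3) ∷ (# 5 , # 0) ∷ [])
  ∷ ((# 2 , # 2) ∷ (# 3 , # 2) ∷ (# 7 , # 0) ∷ (# 0 , # 1) ∷ [])
  ∷ ((# 5 , # 3) ∷ (# 3 , # 3) ∷ (# 1 , # 0) ∷ (# 0 , # 0) ∷ [])
  ∷ ((# 4 , # 3) ∷ (# 8 , # 0) ∷ (# 1 , # 1) ∷ (# 2 , # 1) ∷ [])
  ∷ ((# 5 , # 2) ∷ (# 6 , # 2) ∷ (# 8 , # 1) ∷ (# 3 , # 0) ∷ [])
  ∷ ((# 0 , # 3) ∷ (# 6 , # 3) ∷ (# 4 , # 0) ∷ (# 2 , # 0) ∷ [])
  ∷ ((# 7 , # 2) ∷ (# 8 , # 2) ∷ (# 4 , # 1) ∷ (# 5 , # 1) ∷ [])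
  ∷ ((# 1 , # 2) ∷ (# 8 , # 3) ∷ (# 6 , # 0) ∷ (# 0 , # 2) ∷ [])
  ∷ ((# 3 , # 1) ∷ (# 4 , # 2) ∷ (# 6 , # 1) ∷ (# 7 , # 1) ∷ [])
  ∷ []

faces9 : Vec (Dart 9) 11
faces9 =
    (# 0 , # 0) ∷ (# 0 , # 1) ∷ (# 0 , # 2) ∷ (# 0 , # 3) ∷ (# 1 , # 1)
  ∷ (# 1 , # 2) ∷ (# 2 , # 1) ∷ (# 3 , # 1) ∷ (# 4 , # 1) ∷ (# 4 , # 2)
  ∷ (# 6 , # 1) ∷ []

graph10 : Vec (Vec (Dart 10) 4) 10
graph10 =
    ((# 2 , # 3) ∷ (# 6 , # 3) ∷ (# 5 , # 3) ∷ (# 4 , # 0) ∷ [])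
  ∷ ((# 2 , # 2) ∷ (# 3 , # 2) ∷ (# 9 , # 0) ∷ (# 8 , # 0) ∷ [])
  ∷ ((# 4 , # 3) ∷ (# 3 , # 3) ∷ (# 1 , # 0) ∷ (# 0 , # 0) ∷ [])
  ∷ ((# 4 , # 2) ∷ (# 9 , # 1) ∷ (# 1 , # 1) ∷ (# 2 , # 1) ∷ [])
  ∷ ((# 0 , # 3) ∷ (# 5 , # 2) ∷ (# 3 , # 0) ∷ (# 2 , # 0) ∷ [])
  ∷ ((# 6 , # 2) ∷ (# 7 , # 2) ∷ (# 4 , # 1) ∷ (# 0 , # 2) ∷ [])
  ∷ ((# 8 , # 3) ∷ (# 7 , # 3) ∷ (# 5 , # 0) ∷ (# 0 , # 1) ∷ [])
  ∷ ((# 8 , # 2) ∷ (# 9 , # 2) ∷ (# 5 , # 1) ∷ (# 6 , # 1) ∷ [])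
  ∷ ((# 1 , # 3) ∷ (# 9 , # 3) ∷ (# 7 , # 0) ∷ (# 6 , # 0) ∷ [])
  ∷ ((# 1 , # 2) ∷ (# 3 , # 1) ∷ (# 7 , # 1) ∷ (# 8 , # 1) ∷ [])
  ∷ []

faces10 : Vec (Dart 10) 12
faces10 =
    (# 0 , # 0) ∷ (# 0 , # 1) ∷ (# 0 , # 2) ∷ (# 0 , # 3) ∷ (# 1 , # 1)
  ∷ (# 1 , # 2) ∷ (# 1 , # 3) ∷ (# 2 , # 1) ∷ (# 3 , # 1) ∷ (# 5 , # 1)
  ∷ (# 6 , # 1) ∷ (# 7 , # 1) ∷ []

graph11 : Vec (Vec (Dart 11) 4) 11
graph11 =
    ((# 2 , # 3) ∷ (# 1 , # 3) ∷ (# 8 , # 3) ∷ (# 6 , # 0) ∷ [])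
  ∷ ((# 2 , # 2) ∷ (# 3 , # 2) ∷ (# 10 , # 0) ∷ (# 0 , # 1) ∷ [])
  ∷ ((# 4 , # 3) ∷ (# 3 , # 3) ∷ (# 1 , # 0) ∷ (# 0 , # 0) ∷ [])
  ∷ ((# 4 , # 2) ∷ (# 10 , # 1) ∷ (# 1 , # 1) ∷ (# 2 , # 1) ∷ [])
  ∷ ((# 6 , # 3) ∷ (# 5 , # 3) ∷ (# 3 , # 0) ∷ (# 2 , # 0) ∷ [])
  ∷ ((# 6 , # 2) ∷ (# 7 , # 2) ∷ (# 9 , # 1) ∷ (# 4 , # 1) ∷ [])
  ∷ ((# 0 , # 3) ∷ (# 7 , # 3) ∷ (# 5 , # 0) ∷ (# 4 , # 0) ∷ [])
  ∷ ((# 8 , # 2) ∷ (# 9 , # 2) ∷ (# 5 , # 1) ∷ (# 6 , # 1) ∷ [])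
  ∷ ((# 10 , # 3) ∷ (# 9 , # 3) ∷ (# 7 , # 0) ∷ (# 0 , # 2) ∷ [])
  ∷ ((# 10 , # 2) ∷ (# 5 , # 2) ∷ (# 7 , # 1) ∷ (# 8 , # 1) ∷ [])
  ∷ ((# 1 , # 2) ∷ (# 3 , # 1) ∷ (# 9 , # 0) ∷ (# 8 , # 0) ∷ [])
  ∷ []

faces11 : Vec (Dart 11) 13
faces11 =
    (# 0 , # 0) ∷ (# 0 , # 1) ∷ (# 0 , # 2) ∷ (# 0 , # 3) ∷ (# 1 , # 1)
  ∷ (# 1 , # 2) ∷ (# 2 , # 1) ∷ (# 3 , # 1) ∷ (# 4 , # 1) ∷ (# 5 , # 1)
  ∷ (# 5 , # 2) ∷ (# 7 , # 1) ∷ (# 8 , # 1) ∷ []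

graph12 : Vec (Vec (Dart 12) 4) 12
graph12 =
    ((# 2 , # 3) ∷ (# 1 , # 3) ∷ (# 8 , # 3) ∷ (# 5 , # 0) ∷ [])
  ∷ ((# 2 , # 2) ∷ (# 3 , # 2) ∷ (# 8 , # 0) ∷ (# 0 , # 1) ∷ [])
  ∷ ((# 5 , # 3) ∷ (# 3 , # 3) ∷ (# 1 , # 0) ∷ (# 0 , # 0) ∷ [])
  ∷ ((# 4 , # 3) ∷ (# 10 , # 0) ∷ (# 1 , # 1) ∷ (# 2 , # 1) ∷ [])
  ∷ ((# 5 , # 2) ∷ (# 6 , # 3) ∷ (# 11 , # 0) ∷ (# 3 , # 0) ∷ [])
  ∷ ((# 0 , # 3) ∷ (# 7 , # 3) ∷ (# 4 , # 0) ∷ (# 2 , # 0) ∷ [])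
  ∷ ((# 7 , # 2) ∷ (# 9 , # 2) ∷ (# 11 , # 1) ∷ (# 4 , # 1) ∷ [])
  ∷ ((# 8 , # 2) ∷ (# 9 , # 3) ∷ (# 6 , # 0) ∷ (# 5 , # 1) ∷ [])
  ∷ ((# 1 , # 2) ∷ (# 10 , # 3) ∷ (# 7 , # 0) ∷ (# 0 , # 2) ∷ [])
  ∷ ((# 10 , # 2) ∷ (# 11 , # 2) ∷ (# 6 , # 1) ∷ (# 7 , # 1) ∷ [])
  ∷ ((# 3 , # 1) ∷ (# 11 , # 3) ∷ (# 9 , # 0) ∷ (# 8 , # 1) ∷ [])
  ∷ ((# 4 , # 2) ∷ (# 6 , # 2) ∷ (# 9 , # 1) ∷ (# 10 , # 1) ∷ [])
  ∷ []

faces12 : Vec (Dart 12) 14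
faces12 =
    (# 0 , # 0) ∷ (# 0 , # 1) ∷ (# 0 , # 2) ∷ (# 0 , # 3) ∷ (# 1 , # 1)
  ∷ (# 1 , # 2) ∷ (# 2 , # 1) ∷ (# 3 , # 1) ∷ (# 4 , # 1) ∷ (# 4 , # 2)
  ∷ (# 6 , # 1) ∷ (# 6 , # 2) ∷ (# 7 , # 1) ∷ (# 9 , # 1) ∷ []

graph13 : Vec (Vec (Dart 13) 4) 13
graph13 =
    ((# 2 , # 3) ∷ (# 6 , # 3) ∷ (# 5 , # 3) ∷ (# 4 , # 0) ∷ [])
  ∷ ((# 2 , # 2) ∷ (# 3 , # 2) ∷ (# 11 , # 0) ∷ (# 9 , # 0) ∷ [])
  ∷ ((# 4 , # 3) ∷ (# 3 , # 3) ∷ (# 1 , # 0) ∷ (# 0 , # 0) ∷ [])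
  ∷ ((# 4 , # 2) ∷ (# 12 , # 0) ∷ (# 1 , # 1) ∷ (# 2 , # 1) ∷ [])
  ∷ ((# 0 , # 3) ∷ (# 5 , # 2) ∷ (# 3 , # 0) ∷ (# 2 , # 0) ∷ [])
  ∷ ((# 6 , # 2) ∷ (# 7 , # 3) ∷ (# 4 , # 1) ∷ (# 0 , # 2) ∷ [])
  ∷ ((# 9 , # 3) ∷ (# 8 , # 3) ∷ (# 5 , # 0) ∷ (# 0 , # 1) ∷ [])
  ∷ ((# 8 , # 2) ∷ (# 10 , # 2) ∷ (# 12 , # 1) ∷ (# 5 , # 1) ∷ [])
  ∷ ((# 9 , # 2) ∷ (# 10 , # 3) ∷ (# 7 , # 0) ∷ (# 6 , # 1) ∷ [])
  ∷ ((# 1 , # 3) ∷ (# 11 , # 3) ∷ (# 8 , # 0) ∷ (# 6 , # 0) ∷ [])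
  ∷ ((# 11 , # 2) ∷ (# 12 , # 2) ∷ (# 7 , # 1) ∷ (# 8 , # 1) ∷ [])
  ∷ ((# 1 , # 2) ∷ (# 12 , # 3) ∷ (# 10 , # 0) ∷ (# 9 , # 1) ∷ [])
  ∷ ((# 3 , # 1) ∷ (# 7 , # 2) ∷ (# 10 , # 1) ∷ (# 11 , # 1) ∷ [])
  ∷ []

faces13 : Vec (Dart 13) 15
faces13 =
    (# 0 , # 0) ∷ (# 0 , # 1) ∷ (# 0 , # 2) ∷ (# 0 , # 3) ∷ (# 1 , # 1)
  ∷ (# 1 , # 2) ∷ (# 1 , # 3) ∷ (# 2 , # 1) ∷ (# 3 , # 1) ∷ (# 5 , # 1)
  ∷ (# 6 , # 1) ∷ (# 7 , # 1) ∷ (# 7 , # 2) ∷ (# 8 , # 1) ∷ (# 10 , # 1) ∷ []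

knotGraph8 : SitedKnotGraph 4
knotGraph8 = map , luneFreeKnotGraph , from-yes (site? map)
  where open Certificate.Checked graph8 faces8 (# 0 , # 0)

knotGraph9 : SitedKnotGraph 5
knotGraph9 = map , luneFreeKnotGraph , from-yes (site? map)
  where open Certificate.Checked graph9 faces9 (# 0 , # 0)

knotGraph10 : SitedKnotGraph 6
knotGraph10 = map , luneFreeKnotGraph , from-yes (site? map)
  where open Certificate.Checked graph10 faces10 (# 0 , # 0)

knotGraph11 : SitedKnotGraph 7
knotGraph11 = map , luneFreeKnotGraph , from-yes (site? map)
  where open Certificate.Checked graph11 faces11 (# 0 , # 0)

knotGraph12 : SitedKnotGraph 8
knotGraph12 = map , luneFreeKnotGraph , from-yes (site? map)
  where open Certificate.Checked graph12 faces12 (# 0 , # 0)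

knotGraph13 : SitedKnotGraph 9
knotGraph13 = map , luneFreeKnotGraph , from-yes (site? map)
  where open Certificate.Checked graph13 faces13 (# 0 , # 0)

sitedKnotGraph : ∀ w → SitedKnotGraph (4 + w)
sitedKnotGraph 0 = knotGraph8
sitedKnotGraph 1 = knotGraph9
sitedKnotGraph 2 = knotGraph10
sitedKnotGraph 3 = knotGraph11
sitedKnotGraph 4 = knotGraph12
sitedKnotGraph 5 = knotGraph13
sitedKnotGraph (suc (suc (suc (suc (suc (suc w)))))) =
  let M , G , site = sitedKnotGraph w in Splice.spliced M site G

theorem3 : ∀ (v : ℕ) → v ≥ 8 → ∃ λ (M : Map4 v) → LuneFreeKnotGraph M
theorem3 v 8≤v with w , refl ← m≤n⇒∃[o]m+o≡n 8≤v =
  let M , G , _ = sitedKnotGraph w in M , G
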